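{- Let $p$ be a prime, let $q$ be a power of $p$, and let $s,b$ be integers with $1\le s\le b<q$. Let $L=\{b-s+1,b-s+2,\ldots,b\}$ and assume that $p\nmid\binom{b}{s}$. If $\mathcal{F}\subseteq 2^{[n]}$ is a $q$-modular $L$-differencing Sperner system, then $$|\mathcal{F}|\le\sum_{i=0}^{s}\binom{n-1}{i}.$$
   Context: $n$ is a positive integer, $[n]=\{1,\ldots,n\}$, and $2^{[n]}$ is the family of all subsets of $[n]$. For a positive integer $m$ and $L\subseteq[m-1]$, a family $\mathcal{F}\subseteq 2^{[n]}$ is called $m$-modular $L$-differencing Sperner if for any distinct $A,B\in\mathcal{F}$ there is $\ell\in L$ with $|A\setminus B|\equiv \ell\pmod m$. -}

module Defs where

open import Data.Nat using (ℕ; zero; suc; _+_; _*_; _∸_; _≤_; _<_; _%_)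
open import Data.Nat.Combinatorics using (_C_)
open import Data.Fin.Subset using (Subset; _─_; ∣_∣)
open import Data.List using (List)
open import Data.List.Membership.Propositional using (_∈_)
open import Data.Product using (∃; _×_)
open import Relation.Binary.PropositionalEquality using (_≡_)
open import Data.Sum using (_⊎_)
open import Relation.Nullary using (¬_)

diffSize : ∀ {n} → Subset n → Subset n → ℕ
diffSize A B = ∣ A ─ B ∣

inL : ℕ → ℕ → ℕ → Set
inL s b ℓ = (b ∸ s) + 1 ≤ ℓ × ℓ ≤ b

_≡_[mod_] : ℕ → ℕ → ℕ → Set
x ≡ y [mod m ] = ∃ λ k → (x + k * m ≡ y) ⊎ (y + k * m ≡ x)

-- m-modular L-differencing Sperner family (family given as a duplicate-free list)
-- for distinct A, B ∈ F there is ℓ ∈ L with |A \ B| ≡ ℓ (mod m)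
ModDiffSperner : ∀ {n} (m : ℕ) (L : ℕ → Set) → List (Subset n) → Set
ModDiffSperner m L F =
  ∀ A B → A ∈ F → B ∈ F → ¬ (A ≡ B) →
    ∃ λ ℓ → L ℓ × (diffSize A B ≡ ℓ [mod m ])

sumBinom : ℕ → ℕ → ℕ
sumBinom n zero = n C 0
sumBinom n (suc s) = sumBinom n s + n C suc s

module Submission where

-- Write n = 1 + n′ and q = p ^ k, and split each A ∈ F into the bit [1 ∈ A] and the rest
-- A′ ⊆ [n′]. With c = b + n′q, the function f_A Y = C(c − |A′ ∖ Y|, s) on subsets Y of [n′]
-- is a multilinear polynomial of degree ≤ s in the indicator variables of Y, so all f_A lie
-- in a space of dimension Σ_{i≤s} C(n′, i). Since p ∣ C(q, i) for 0 < i < q, the binomial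
-- coefficients C(x, i) with i < q are q-periodic in x modulo p. Hence f_A(A′) ≡ C(b, s) ≢ 0,
-- while for A ≠ B with [1 ∈ A] ≤ [1 ∈ B] we have |A ∖ B| = |A′ ∖ B′| ≡ ℓ (mod q) for some
-- ℓ ∈ L, so f_A(B′) ≡ C(b − ℓ, s) = 0 as b − ℓ < s. The matrix (f_A(B′)) is therefore block
-- triangular with diagonal entries prime to p, so the f_A are linearly independent over 𝔽ₚ
-- and |F| is at most the dimension.

open import Defs
open import Data.Bool as Bool using (Bool; true; false; if_then_else_; b≤b)
open import Data.Bool.Properties using (≤-maximum)
open import Data.Fin using (Fin; zero; suc; punchIn; punchOut)
open import Data.Fin.Properties using (all?; ¬∀⟶∃¬; punchIn-punchOut; punchInᵢ≢i)
  renaming (_≟_ to _≟ᶠ_)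
open import Data.Fin.Subset using (Subset; _─_; ∣_∣)
open import Data.Fin.Subset.Properties using (∣p∣≤n)
open import Data.List using (List; length; lookup)
open import Data.List.Membership.Propositional.Properties using (∈-lookup)
open import Data.List.Relation.Unary.All as All using ()
open import Data.List.Relation.Unary.AllPairs using (_∷_)
open import Data.List.Relation.Unary.Unique.Propositional using (Unique)
open import Data.Nat
open import Data.Nat.Combinatorics using (_C_; k>n⇒nCk≡0; nC1≡n; nCk+nC[k+1]≡[n+1]C[k+1])
open import Data.Nat.Divisibility
open import Data.Nat.DivMod using (%-distribˡ-+)
open import Data.Nat.Primality using (Prime; euclidsLemma; prime⇒nonZero; prime⇒nonTrivial)
open import Data.Nat.Properties
open import Data.Nat.Tactic.RingSolver using (solve-∀)
open import Data.Product using (∃; _×_; _,_; proj₁; proj₂)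
open import Data.Sum using (inj₁; inj₂; [_,_]′)
open import Data.Vec using ([]; _∷_; head; tail)
open import Data.Vec.Functional using (Vector; _++_; take; drop)
open import Data.Vec.Functional.Properties using (lookup-++ˡ; lookup-++ʳ)
open import Function using (_∘_)
open import Relation.Binary.PropositionalEquality
open import Relation.Nullary using (¬_; yes; no; contradiction)
open import Algebra.Properties.Semiring.Sum +-*-semiring
  using (sum-syntax; sum-remove; ∑-distrib-+; sum-replicate-zero; sum-cong-≗)

open ≡-Reasoning

[1+k]*[1+n]C[1+k]≡[1+n]*nCk : ∀ n k → suc k * (suc n C suc k) ≡ suc n * (n C k)
[1+k]*[1+n]C[1+k]≡[1+n]*nCk zero    zero    = refl
[1+k]*[1+n]C[1+k]≡[1+n]*nCk zero    (suc k) = *-zeroʳ (2 + k)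
[1+k]*[1+n]C[1+k]≡[1+n]*nCk (suc n) zero    =
  trans (*-identityˡ _) (trans (nC1≡n (2 + n)) (sym (*-identityʳ (2 + n))))
[1+k]*[1+n]C[1+k]≡[1+n]*nCk (suc n) (suc k) = begin
  (2 + k) * ((2 + n) C (2 + k))                  ≡⟨ cong ((2 + k) *_) (pascal (suc n) (suc k)) ⟨
  (2 + k) * (a + b)                              ≡⟨ regroup₁ k a b ⟩
  (1 + k) * a + a + (2 + k) * b                  ≡⟨ cong₂ (λ x y → x + a + y)
                                                          ([1+k]*[1+n]C[1+k]≡[1+n]*nCk n k)
                                                          ([1+k]*[1+n]C[1+k]≡[1+n]*nCk n (suc k)) ⟩
  (1 + n) * (n C k) + a + (1 + n) * (n C suc k)  ≡⟨ regroup₂ n (n C k) (n C suc k) a ⟩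
  (1 + n) * (n C k + n C suc k) + a              ≡⟨ cong (λ x → (1 + n) * x + a) (pascal n k) ⟩
  (1 + n) * a + a                                ≡⟨ regroup₃ n a ⟩
  (2 + n) * a                                    ∎
  where
  pascal = nCk+nC[k+1]≡[n+1]C[k+1]
  a = suc n C suc k
  b = suc n C suc (suc k)
  regroup₁ : ∀ k a b → (2 + k) * (a + b) ≡ (1 + k) * a + a + (2 + k) * b
  regroup₁ = solve-∀
  regroup₂ : ∀ n c d a → (1 + n) * c + a + (1 + n) * d ≡ (1 + n) * (c + d) + a
  regroup₂ = solve-∀
  regroup₃ : ∀ n a → (1 + n) * a + a ≡ (2 + n) * a
  regroup₃ = solve-∀

n∣[1+k]*nC[1+k] : ∀ n k .{{_ : NonZero n}} → n ∣ suc k * (n C suc k)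
n∣[1+k]*nC[1+k] (suc n) k =
  divides (n C k) (trans ([1+k]*[1+n]C[1+k]≡[1+n]*nCk n k) (*-comm (suc n) (n C k)))

sumBinom-zero : ∀ s → sumBinom 0 s ≡ 1
sumBinom-zero zero    = refl
sumBinom-zero (suc s) = trans (+-identityʳ _) (sumBinom-zero s)

sumBinom-suc : ∀ n s → sumBinom (suc n) (suc s) ≡ sumBinom n (suc s) + sumBinom n s
sumBinom-suc n zero    = begin
  1 + suc n C 1    ≡⟨ cong (1 +_) (nCk+nC[k+1]≡[n+1]C[k+1] n 0) ⟨
  1 + (1 + n C 1)  ≡⟨ +-comm 1 (1 + n C 1) ⟩
  1 + n C 1 + 1    ∎
sumBinom-suc n (suc s) = begin
  sumBinom (suc n) (suc s) + suc n C (2 + s)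
    ≡⟨ cong₂ _+_ (sumBinom-suc n s) (sym (nCk+nC[k+1]≡[n+1]C[k+1] n (suc s))) ⟩
  (sumBinom n (suc s) + sumBinom n s) + (n C suc s + n C (2 + s))
    ≡⟨ regroup (sumBinom n (suc s)) (sumBinom n s) (n C suc s) (n C (2 + s)) ⟩
  (sumBinom n (suc s) + n C (2 + s)) + (sumBinom n s + n C suc s)
    ∎
  where
  regroup : ∀ a b x y → (a + b) + (x + y) ≡ (a + y) + (b + x)
  regroup = solve-∀

∣-∑ : ∀ {d m} (f : Fin m → ℕ) → (∀ i → d ∣ f i) → d ∣ ∑[ i < m ] f i
∣-∑ {d} {zero}  f _   = d ∣0
∣-∑ {d} {suc m} f d∣f = ∣m∣n⇒∣m+n (d∣f zero) (∣-∑ (f ∘ suc) (d∣f ∘ suc))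

∣∑∧∣others⇒∣ : ∀ {d m} (f : Fin m → ℕ) j →
               d ∣ ∑[ i < m ] f i → (∀ i → i ≢ j → d ∣ f i) → d ∣ f j
∣∑∧∣others⇒∣ {d} {suc m} f j d∣∑f d∣others =
  ∣m+n∣m⇒∣n (subst (d ∣_) (trans (sum-remove {i = j} f) (+-comm (f j) _)) d∣∑f)
            (∣-∑ (f ∘ punchIn j) (λ k → d∣others (punchIn j k) (punchInᵢ≢i j k)))

∑-elimination : ∀ {m} (c x y : Fin m → ℕ) (a P z : ℕ) →
  ∑[ i < m ] (c i * (a * x i + P * (y i * z))) ≡
  P * (∑[ i < m ] (c i * y i)) * z + ∑[ i < m ] (a * c i * x i)
∑-elimination {zero}  c x y a P z = cong (λ u → u * z + 0) (sym (*-zeroʳ P))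
∑-elimination {suc m} c x y a P z
  rewrite ∑-elimination (c ∘ suc) (x ∘ suc) (y ∘ suc) a P z =
  regroup (c zero) (x zero) (y zero) a P z _ _
  where
  regroup : ∀ c x y a P z S T →
    c * (a * x + P * (y * z)) + (P * S * z + T) ≡ P * (c * y + S) * z + (a * c * x + T)
  regroup = solve-∀

polyDim : ℕ → ℕ → ℕ
polyDim zero    _       = 1
polyDim (suc n) zero    = 1
polyDim (suc n) (suc s) = polyDim n (suc s) + polyDim n s

-- A vector in ℕ^(polyDim n s) is the coefficient vector of a multilinear polynomial of
-- degree ≤ s in the indicator variables of Y ⊆ [n], split as f (y ∷ Y) = f₀ Y + y · f₁ Y
-- with deg f₀ ≤ s and deg f₁ ≤ s − 1.
eval : ∀ n s → Vector ℕ (polyDim n s) → Subset n → ℕ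
eval zero    _       a _       = a zero
eval (suc n) zero    a _       = a zero
eval (suc n) (suc s) a (y ∷ Y) =
  eval n (suc s) (take _ a) Y + (if y then eval n s (drop _ a) Y else 0)

IsPolynomial : ∀ n s → (Subset n → ℕ) → Set
IsPolynomial n s f = ∃ λ a → ∀ Y → f Y ≡ eval n s a Y

polyDim≡sumBinom : ∀ n s → polyDim n s ≡ sumBinom n s
polyDim≡sumBinom zero    s       = sym (sumBinom-zero s)
polyDim≡sumBinom (suc n) zero    = refl
polyDim≡sumBinom (suc n) (suc s) = begin
  polyDim n (suc s) + polyDim n s    ≡⟨ cong₂ _+_ (polyDim≡sumBinom n (suc s)) (polyDim≡sumBinom n s) ⟩
  sumBinom n (suc s) + sumBinom n s  ≡⟨ sumBinom-suc n s ⟨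
  sumBinom (suc n) (suc s)           ∎

eval-cong : ∀ n s {a b} → (∀ k → a k ≡ b k) → ∀ Y → eval n s a Y ≡ eval n s b Y
eval-cong zero    _       a≗b _           = a≗b zero
eval-cong (suc n) zero    a≗b _           = a≗b zero
eval-cong (suc n) (suc s) a≗b (true  ∷ Y) =
  cong₂ _+_ (eval-cong n (suc s) (a≗b ∘ _) Y) (eval-cong n s (a≗b ∘ _) Y)
eval-cong (suc n) (suc s) a≗b (false ∷ Y) = cong (_+ 0) (eval-cong n (suc s) (a≗b ∘ _) Y)

eval-linear : ∀ n s {m} (c : Fin m → ℕ) (a : Fin m → Vector ℕ (polyDim n s)) Y →
  eval n s (λ k → ∑[ i < m ] (c i * a i k)) Y ≡ ∑[ i < m ] (c i * eval n s (a i) Y)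
eval-linear zero    _       c a _ = refl
eval-linear (suc n) zero    c a _ = refl
eval-linear (suc n) (suc s) {m} c a (true  ∷ Y) = begin
  eval n (suc s) _ Y + eval n s _ Y
    ≡⟨ cong₂ _+_ (eval-linear n (suc s) c (take _ ∘ a) Y) (eval-linear n s c (drop _ ∘ a) Y) ⟩
  ∑[ i < m ] (c i * f₀ i) + ∑[ i < m ] (c i * f₁ i)
    ≡⟨ ∑-distrib-+ (λ i → c i * f₀ i) (λ i → c i * f₁ i) ⟨
  ∑[ i < m ] (c i * f₀ i + c i * f₁ i)
    ≡⟨ sum-cong-≗ (λ i → *-distribˡ-+ (c i) (f₀ i) (f₁ i)) ⟨
  ∑[ i < m ] (c i * (f₀ i + f₁ i))
    ∎
  where
  f₀ f₁ : Fin m → ℕ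
  f₀ i = eval n (suc s) (take _ (a i)) Y
  f₁ i = eval n s (drop _ (a i)) Y
eval-linear (suc n) (suc s) {m} c a (false ∷ Y) = begin
  eval n (suc s) _ Y + 0
    ≡⟨ +-identityʳ _ ⟩
  eval n (suc s) _ Y
    ≡⟨ eval-linear n (suc s) c (take _ ∘ a) Y ⟩
  ∑[ i < m ] (c i * eval n (suc s) (take _ (a i)) Y)
    ≡⟨ sum-cong-≗ (λ i → cong (c i *_) (+-identityʳ _)) ⟨
  ∑[ i < m ] (c i * eval (suc n) (suc s) (a i) (false ∷ Y))
    ∎

eval-zero : ∀ n s Y → eval n s (λ _ → 0) Y ≡ 0
eval-zero n s = eval-linear n s {zero} (λ ()) (λ ())

∣-eval : ∀ {d} n s a → (∀ k → d ∣ a k) → ∀ Y → d ∣ eval n s a Y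
∣-eval     zero    _       _ d∣a _           = d∣a zero
∣-eval     (suc n) zero    _ d∣a _           = d∣a zero
∣-eval     (suc n) (suc s) _ d∣a (true  ∷ Y) =
  ∣m∣n⇒∣m+n (∣-eval n (suc s) _ (d∣a ∘ _) Y) (∣-eval n s _ (d∣a ∘ _) Y)
∣-eval {d} (suc n) (suc s) _ d∣a (false ∷ Y) =
  ∣m∣n⇒∣m+n (∣-eval n (suc s) _ (d∣a ∘ _) Y) (d ∣0)

eval-++ : ∀ n s a b y Y →
  eval (suc n) (suc s) (a ++ b) (y ∷ Y) ≡ eval n (suc s) a Y + (if y then eval n s b Y else 0)
eval-++ n s a b true  Y =
  cong₂ _+_ (eval-cong n (suc s) (lookup-++ˡ a b) Y) (eval-cong n s (lookup-++ʳ a b) Y)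
eval-++ n s a b false Y = cong (_+ 0) (eval-cong n (suc s) (lookup-++ˡ a b) Y)

eval-++-zero : ∀ n s a y Y → eval (suc n) (suc s) (a ++ λ _ → 0) (y ∷ Y) ≡ eval n (suc s) a Y
eval-++-zero n s a true  Y = begin
  eval (suc n) (suc s) (a ++ λ _ → 0) (true ∷ Y)  ≡⟨ eval-++ n s a _ true Y ⟩
  eval n (suc s) a Y + eval n s (λ _ → 0) Y       ≡⟨ cong (eval n (suc s) a Y +_) (eval-zero n s Y) ⟩
  eval n (suc s) a Y + 0                          ≡⟨ +-identityʳ _ ⟩
  eval n (suc s) a Y                              ∎
eval-++-zero n s a false Y = trans (eval-++ n s a _ false Y) (+-identityʳ _)

[c∸∣X─Y∣]Cs-isPolynomial : ∀ n s c (X : Subset n) → n ≤ c →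
                            IsPolynomial n s (λ Y → (c ∸ ∣ X ─ Y ∣) C s)
[c∸∣X─Y∣]Cs-isPolynomial zero    s       c       []          _ = (λ _ → c C s) , λ { [] → refl }
[c∸∣X─Y∣]Cs-isPolynomial (suc n) zero    c       X           _ = (λ _ → 1) , λ _ → refl
[c∸∣X─Y∣]Cs-isPolynomial (suc n) (suc s) c       (false ∷ X) 1+n≤c
  with a , f≡a ← [c∸∣X─Y∣]Cs-isPolynomial n (suc s) c X (≤-trans (n≤1+n n) 1+n≤c) =
  (a ++ λ _ → 0) , λ where
    (true  ∷ Y) → trans (f≡a Y) (sym (eval-++-zero n s a true  Y))
    (false ∷ Y) → trans (f≡a Y) (sym (eval-++-zero n s a false Y))
[c∸∣X─Y∣]Cs-isPolynomial (suc n) (suc s) (suc c) (true  ∷ X) (s≤s n≤c)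
  with a₁ , f≡a₁ ← [c∸∣X─Y∣]Cs-isPolynomial n (suc s) c X n≤c
     | a₀ , f≡a₀ ← [c∸∣X─Y∣]Cs-isPolynomial n s c X n≤c =
  (a₁ ++ a₀) , λ where
    (true  ∷ Y) → begin
      (suc c ∸ ∣ X ─ Y ∣) C suc s
        ≡⟨ cong (_C suc s) (+-∸-assoc 1 (≤-trans (∣p∣≤n (X ─ Y)) n≤c)) ⟩
      suc (c ∸ ∣ X ─ Y ∣) C suc s
        ≡⟨ nCk+nC[k+1]≡[n+1]C[k+1] (c ∸ ∣ X ─ Y ∣) s ⟨
      (c ∸ ∣ X ─ Y ∣) C s + (c ∸ ∣ X ─ Y ∣) C suc s
        ≡⟨ +-comm ((c ∸ ∣ X ─ Y ∣) C s) _ ⟩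
      (c ∸ ∣ X ─ Y ∣) C suc s + (c ∸ ∣ X ─ Y ∣) C s
        ≡⟨ cong₂ _+_ (f≡a₁ Y) (f≡a₀ Y) ⟩
      eval n (suc s) a₁ Y + eval n s a₀ Y
        ≡⟨ eval-++ n s a₁ a₀ true Y ⟨
      eval (suc n) (suc s) (a₁ ++ a₀) (true ∷ Y)
        ∎
    (false ∷ Y) → trans (f≡a₁ Y) (sym (trans (eval-++ n s a₁ a₀ false Y) (+-identityʳ _)))

∣X─X∣≡0 : ∀ {n} (X : Subset n) → ∣ X ─ X ∣ ≡ 0
∣X─X∣≡0 []          = refl
∣X─X∣≡0 (true  ∷ X) = ∣X─X∣≡0 X
∣X─X∣≡0 (false ∷ X) = ∣X─X∣≡0 X

∣A─B∣≡∣tailA─tailB∣ : ∀ {n} (A B : Subset (suc n)) → head A Bool.≤ head B →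
                      ∣ A ─ B ∣ ≡ ∣ tail A ─ tail B ∣
∣A─B∣≡∣tailA─tailB∣ (true  ∷ X) (true  ∷ Y) _ = refl
∣A─B∣≡∣tailA─tailB∣ (false ∷ X) (true  ∷ Y) _ = refl
∣A─B∣≡∣tailA─tailB∣ (false ∷ X) (false ∷ Y) _ = refl

lookup-injective : ∀ {A : Set} {xs : List A} → Unique xs →
                   ∀ i j → lookup xs i ≡ lookup xs j → i ≡ j
lookup-injective (_  ∷ _)  zero    zero    _  = refl
lookup-injective (x∉ ∷ _)  zero    (suc j) eq = contradiction eq (All.lookup x∉ (∈-lookup j))
lookup-injective (x∉ ∷ _)  (suc i) zero    eq = contradiction (sym eq) (All.lookup x∉ (∈-lookup i))
lookup-injective (_  ∷ xs) (suc i) (suc j) eq = cong suc (lookup-injective xs i j eq)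

b∸ℓ<s : ∀ {s b ℓ} → b ∸ s + 1 ≤ ℓ → ℓ ≤ b → b ∸ ℓ < s
b∸ℓ<s {s} {b} {ℓ} b∸s+1≤ℓ ℓ≤b = +-cancelʳ-< ℓ (b ∸ ℓ) s
  (subst (_< s + ℓ) (sym (m∸n+n≡m ℓ≤b))
    (≤-<-trans (m≤n+m∸n b s) (+-monoʳ-< s (subst (_≤ ℓ) (+-comm (b ∸ s) 1) b∸s+1≤ℓ))))

x+d≡c⇒c∸d≡x : ∀ {x d c} → x + d ≡ c → c ∸ d ≡ x
x+d≡c⇒c∸d≡x {x} {d} refl = m+n∸n≡m x d

b+n*q∸d≡b∸ℓ+j*q : ∀ {q} .{{_ : NonZero q}} {b n d ℓ} → d ≤ n → ℓ ≤ b → d ≡ ℓ [mod q ] →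
                  ∃ λ j → b + n * q ∸ d ≡ b ∸ ℓ + j * q
b+n*q∸d≡b∸ℓ+j*q {q} {b} {n} {d} {ℓ} _ ℓ≤b (t , inj₁ d+tq≡ℓ) = t + n , x+d≡c⇒c∸d≡x (begin
  b ∸ ℓ + (t + n) * q + d      ≡⟨ regroup (b ∸ ℓ) t n q d ⟩
  b ∸ ℓ + (d + t * q) + n * q  ≡⟨ cong (λ x → b ∸ ℓ + x + n * q) d+tq≡ℓ ⟩
  b ∸ ℓ + ℓ + n * q            ≡⟨ cong (_+ n * q) (m∸n+n≡m ℓ≤b) ⟩
  b + n * q                    ∎)
  where
  regroup : ∀ r t n q d → r + (t + n) * q + d ≡ r + (d + t * q) + n * q
  regroup = solve-∀
b+n*q∸d≡b∸ℓ+j*q {q} {b} {n} {d} {ℓ} d≤n ℓ≤b (t , inj₂ ℓ+tq≡d) = n ∸ t , x+d≡c⇒c∸d≡x (begin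
  b ∸ ℓ + (n ∸ t) * q + d            ≡⟨ cong (b ∸ ℓ + (n ∸ t) * q +_) ℓ+tq≡d ⟨
  b ∸ ℓ + (n ∸ t) * q + (ℓ + t * q)  ≡⟨ regroup (b ∸ ℓ) (n ∸ t) ℓ t q ⟩
  b ∸ ℓ + ℓ + (n ∸ t + t) * q        ≡⟨ cong₂ (λ x y → x + y * q) (m∸n+n≡m ℓ≤b) (m∸n+n≡m t≤n) ⟩
  b + n * q                          ∎)
  where
  regroup : ∀ r u ℓ t q → r + u * q + (ℓ + t * q) ≡ r + ℓ + (u + t) * q
  regroup = solve-∀
  t≤n : t ≤ n
  t≤n = ≤-trans (m≤m*n t q) (≤-trans (m≤n+m (t * q) ℓ) (≤-trans (≤-reflexive ℓ+tq≡d) d≤n))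

IndependentMod : ℕ → ∀ {m N} → (Fin m → Fin N → ℕ) → Set
IndependentMod p {m} v =
  ∀ (c : Fin m → ℕ) → (∀ t → p ∣ ∑[ i < m ] (c i * v i t)) → ∀ i → p ∣ c i

DependentMod : ℕ → ∀ {m N} → (Fin m → Fin N → ℕ) → Set
DependentMod p {m} v =
  ∃ λ (c : Fin m → ℕ) → (∃ λ i → p ∤ c i) × (∀ t → p ∣ ∑[ i < m ] (c i * v i t))

module _ {p : ℕ} (p-prime : Prime p) where

  private instance
    p≢0 : NonZero p
    p≢0 = prime⇒nonZero p-prime

  p∤1 : p ∤ 1
  p∤1 p∣1 = nonTrivial⇒≢1 {{prime⇒nonTrivial p-prime}} (∣1⇒≡1 p∣1)

  p^k∣m*n⇒p^k∣m : ∀ k {m n} → p ∤ n → p ^ k ∣ m * n → p ^ k ∣ m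
  p^k∣m*n⇒p^k∣m zero    _ _ = 1∣ _
  p^k∣m*n⇒p^k∣m (suc k) {m} {n} p∤n p^[1+k]∣mn
    with euclidsLemma m n p-prime (∣-trans (m∣m*n (p ^ k)) p^[1+k]∣mn)
  ... | inj₂ p∣n = contradiction p∣n p∤n
  ... | inj₁ (divides t refl) = subst (p * p ^ k ∣_) (*-comm p t) (*-monoʳ-∣ p p^k∣t)
    where
    tpn≡ptn : t * p * n ≡ p * (t * n)
    tpn≡ptn = trans (cong (_* n) (*-comm t p)) (*-assoc p t n)
    p^k∣t : p ^ k ∣ t
    p^k∣t = p^k∣m*n⇒p^k∣m k p∤n (*-cancelˡ-∣ p (subst (p * p ^ k ∣_) tpn≡ptn p^[1+k]∣mn))

  p∣[p^k]Ci : ∀ k {i} → 0 < i → i < p ^ k → p ∣ p ^ k C i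
  p∣[p^k]Ci k {suc i} _ i<p^k with p ∣? p ^ k C suc i
  ... | yes p∣ = p∣
  ... | no  p∤ = contradiction
    (∣⇒≤ (p^k∣m*n⇒p^k∣m k p∤ (n∣[1+k]*nC[1+k] (p ^ k) i {{m^n≢0 p k}})))
    (<⇒≱ i<p^k)

  [x+p^k]Ci≡xCi : ∀ k x i → i < p ^ k → ((x + p ^ k) C i) % p ≡ (x C i) % p
  [x+p^k]Ci≡xCi k x       zero    _     = refl
  [x+p^k]Ci≡xCi k zero    (suc i) i<p^k = begin
    (p ^ k C suc i) % p  ≡⟨ n∣m⇒m%n≡0 _ p (p∣[p^k]Ci k z<s i<p^k) ⟩
    0                    ≡⟨ n∣m⇒m%n≡0 0 p (p ∣0) ⟨
    0 % p                ∎
  [x+p^k]Ci≡xCi k (suc x) (suc i) i<p^k = begin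
    (suc (x + p ^ k) C suc i) % p
      ≡⟨ cong (_% p) (nCk+nC[k+1]≡[n+1]C[k+1] (x + p ^ k) i) ⟨
    ((x + p ^ k) C i + (x + p ^ k) C suc i) % p
      ≡⟨ %-distribˡ-+ ((x + p ^ k) C i) _ p ⟩
    (((x + p ^ k) C i) % p + ((x + p ^ k) C suc i) % p) % p
      ≡⟨ cong₂ (λ u v → (u + v) % p) ([x+p^k]Ci≡xCi k x i (<-trans (n<1+n i) i<p^k))
                                     ([x+p^k]Ci≡xCi k x (suc i) i<p^k) ⟩
    ((x C i) % p + (x C suc i) % p) % p
      ≡⟨ %-distribˡ-+ (x C i) _ p ⟨
    (x C i + x C suc i) % p
      ≡⟨ cong (_% p) (nCk+nC[k+1]≡[n+1]C[k+1] x i) ⟩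
    (suc x C suc i) % p
      ∎

  [x+j*p^k]Ci≡xCi : ∀ k j x i → i < p ^ k → ((x + j * p ^ k) C i) % p ≡ (x C i) % p
  [x+j*p^k]Ci≡xCi k zero    x i _     = cong (λ y → (y C i) % p) (+-identityʳ x)
  [x+j*p^k]Ci≡xCi k (suc j) x i i<p^k = begin
    ((x + (p ^ k + j * p ^ k)) C i) % p  ≡⟨ cong (λ y → (y C i) % p) x+[q+jq]≡x+jq+q ⟩
    ((x + j * p ^ k + p ^ k) C i) % p    ≡⟨ [x+p^k]Ci≡xCi k (x + j * p ^ k) i i<p^k ⟩
    ((x + j * p ^ k) C i) % p            ≡⟨ [x+j*p^k]Ci≡xCi k j x i i<p^k ⟩
    (x C i) % p                          ∎
    where
    x+[q+jq]≡x+jq+q : x + (p ^ k + j * p ^ k) ≡ x + j * p ^ k + p ^ k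
    x+[q+jq]≡x+jq+q =
      trans (cong (x +_) (+-comm (p ^ k) (j * p ^ k))) (sym (+-assoc x (j * p ^ k) (p ^ k)))

  p∣[b+n*p^k∸d]Cs : ∀ {k s b n d ℓ} → s ≤ b → b < p ^ k → d ≤ n → inL s b ℓ →
                    d ≡ ℓ [mod p ^ k ] → p ∣ (b + n * p ^ k ∸ d) C s
  p∣[b+n*p^k∸d]Cs {k} {s} {b} {n} {d} {ℓ} s≤b b<p^k d≤n (b∸s+1≤ℓ , ℓ≤b) d≡ℓ
    with j , b+nq∸d≡b∸ℓ+jq ← b+n*q∸d≡b∸ℓ+j*q {{m^n≢0 p k}} d≤n ℓ≤b d≡ℓ = m%n≡0⇒n∣m _ p (begin
      ((b + n * p ^ k ∸ d) C s) % p  ≡⟨ cong (λ x → (x C s) % p) b+nq∸d≡b∸ℓ+jq ⟩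
      ((b ∸ ℓ + j * p ^ k) C s) % p  ≡⟨ [x+j*p^k]Ci≡xCi k j (b ∸ ℓ) s (≤-<-trans s≤b b<p^k) ⟩
      ((b ∸ ℓ) C s) % p              ≡⟨ cong (_% p) (k>n⇒nCk≡0 (b∸ℓ<s {s} {b} b∸s+1≤ℓ ℓ≤b)) ⟩
      0 % p                          ≡⟨ n∣m⇒m%n≡0 0 p (p ∣0) ⟩
      0                              ∎)

  p∤[b+n*p^k]Cs : ∀ {k s b} n → s < p ^ k → p ∤ b C s → p ∤ (b + n * p ^ k) C s
  p∤[b+n*p^k]Cs {k} {s} {b} n s<p^k p∤bCs p∣ = p∤bCs (m%n≡0⇒n∣m _ p
    (trans (sym ([x+j*p^k]Ci≡xCi k n b s s<p^k)) (n∣m⇒m%n≡0 _ p p∣)))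

  n≤b+n*p^k : ∀ k b n → n ≤ b + n * p ^ k
  n≤b+n*p^k k b n = ≤-trans (m≤m*n n (p ^ k) {{m^n≢0 p k}}) (m≤n+m _ b)

  -- Clears column j using row 0 as pivot: row i becomes v 0 j · v (1+i) − v (1+i) j · v 0,
  -- with −1 represented by pred p.
  eliminate : ∀ {m N} → (Fin (suc m) → Fin (suc N) → ℕ) → Fin (suc N) → Fin m → Fin N → ℕ
  eliminate v j i t =
    v zero j * v (suc i) (punchIn j t) + pred p * (v (suc i) j * v zero (punchIn j t))

  dependentMod-from-eliminate : ∀ {m N} (v : Fin (suc m) → Fin (suc N) → ℕ) j → p ∤ v zero j →
                                DependentMod p (eliminate v j) → DependentMod p v
  dependentMod-from-eliminate {m} {N} v j p∤a (c′ , (i₀ , p∤c′i₀) , p∣∑c′w) =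
    c , (suc i₀ , p∤ci₀) , p∣∑cv
    where
    a = v zero j
    c : Fin (suc m) → ℕ
    c zero    = pred p * ∑[ i < m ] (c′ i * v (suc i) j)
    c (suc i) = a * c′ i
    p∤ci₀ : p ∤ a * c′ i₀
    p∤ci₀ p∣ = [ p∤a , p∤c′i₀ ]′ (euclidsLemma a (c′ i₀) p-prime p∣)
    combined : Fin (suc N) → ℕ
    combined u = ∑[ i < m ] (c′ i * (a * v (suc i) u + pred p * (v (suc i) j * v zero u)))
    ∑cv≡combined : ∀ t → ∑[ i < suc m ] (c i * v i t) ≡ combined t
    ∑cv≡combined t =
      sym (∑-elimination c′ (λ i → v (suc i) t) (λ i → v (suc i) j) a (pred p) (v zero t))
    p∣column-j : ∀ i → p ∣ c′ i * (a * v (suc i) j + pred p * (v (suc i) j * a))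
    p∣column-j i = subst (p ∣_) (sym (begin
      c′ i * (a * h + pred p * (h * a))  ≡⟨ regroup (c′ i) h a (pred p) ⟩
      suc (pred p) * (c′ i * h * a)      ≡⟨ cong (_* (c′ i * h * a)) (suc-pred p) ⟩
      p * (c′ i * h * a)                 ∎)) (m∣m*n _)
      where
      h = v (suc i) j
      regroup : ∀ c h a P → c * (a * h + P * (h * a)) ≡ suc P * (c * h * a)
      regroup = solve-∀
    p∣∑cv : ∀ t → p ∣ ∑[ i < suc m ] (c i * v i t)
    p∣∑cv t rewrite ∑cv≡combined t with j ≟ᶠ t
    ... | yes refl = ∣-∑ _ p∣column-j
    ... | no  j≢t  = subst (λ u → p ∣ combined u) (punchIn-punchOut j≢t) (p∣∑c′w (punchOut j≢t))

  dependentMod : ∀ {N m} → N < m → (v : Fin m → Fin N → ℕ) → DependentMod p v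
  dependentMod {zero}  {suc m} _ v = (λ _ → 1) , (zero , p∤1) , λ ()
  dependentMod {suc N} {suc m} (s≤s N<m) v with all? (λ t → p ∣? v zero t)
  ... | yes p∣v₀ = e₀ , (zero , p∤1) , λ t → subst (p ∣_) (sym (∑e₀v≡v₀ t)) (p∣v₀ t)
    where
    e₀ : Fin (suc m) → ℕ
    e₀ zero    = 1
    e₀ (suc _) = 0
    ∑e₀v≡v₀ : ∀ t → ∑[ i < suc m ] (e₀ i * v i t) ≡ v zero t
    ∑e₀v≡v₀ t = trans (cong (1 * v zero t +_) (sum-replicate-zero m))
                      (trans (+-identityʳ _) (*-identityˡ _))
  ... | no ¬p∣v₀ with ¬∀⟶∃¬ _ _ (λ t → p ∣? v zero t) ¬p∣v₀
  ... | j , p∤v₀j = dependentMod-from-eliminate v j p∤v₀j (dependentMod N<m (eliminate v j))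

  independentMod⇒≤ : ∀ {m N} (v : Fin m → Fin N → ℕ) → IndependentMod p v → m ≤ N
  independentMod⇒≤ {m} {N} v independent with m ≤? N
  ... | yes m≤N = m≤N
  ... | no  m≰N with dependentMod (≰⇒> m≰N) v
  ... | c , (i , p∤ci) , p∣∑cv = contradiction (independent c p∣∑cv i) p∤ci

  blockTriangular⇒independentMod : ∀ {m} (M : Fin m → Fin m → ℕ) (top : Fin m → Bool) →
    (∀ j → p ∤ M j j) → (∀ i j → i ≢ j → top i Bool.≤ top j → p ∣ M i j) → IndependentMod p M
  blockTriangular⇒independentMod M top p∤Mjj p∣Mij c p∣∑cM = p∣c
    where
    p∣c-from-others : ∀ j → (∀ i → i ≢ j → p ∣ c i * M i j) → p ∣ c j
    p∣c-from-others j p∣others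
      with euclidsLemma (c j) (M j j) p-prime
             (∣∑∧∣others⇒∣ (λ i → c i * M i j) j (p∣∑cM j) p∣others)
    ... | inj₁ p∣cj  = p∣cj
    ... | inj₂ p∣Mjj = contradiction p∣Mjj (p∤Mjj j)
    p∣c-top : ∀ j → top j ≡ true → p ∣ c j
    p∣c-top j topj = p∣c-from-others j λ i i≢j →
      ∣n⇒∣m*n (c i) (p∣Mij i j i≢j (subst (top i Bool.≤_) (sym topj) (≤-maximum (top i))))
    p∣cM-bottom : ∀ i j → i ≢ j → top j ≡ false → p ∣ c i * M i j
    p∣cM-bottom i j i≢j topj with top i in topi
    ... | true  = ∣m⇒∣m*n (M i j) (p∣c-top i topi)
    ... | false = ∣n⇒∣m*n (c i) (p∣Mij i j i≢j (subst₂ Bool._≤_ (sym topi) (sym topj) b≤b))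
    p∣c : ∀ j → p ∣ c j
    p∣c j with top j in topj
    ... | true  = p∣c-top j topj
    ... | false = p∣c-from-others j λ i i≢j → p∣cM-bottom i j i≢j topj

  independentMod-polynomials⇒≤polyDim : ∀ {n s m m′} (f : Fin m → Subset n → ℕ)
    (Y : Fin m′ → Subset n) → (∀ i → IsPolynomial n s (f i)) →
    IndependentMod p (λ i j → f i (Y j)) → m ≤ polyDim n s
  independentMod-polynomials⇒≤polyDim {n} {s} {m} f Y f-poly independent =
    independentMod⇒≤ a independent-a
    where
    a : Fin m → Vector ℕ (polyDim n s)
    a i = proj₁ (f-poly i)
    independent-a : IndependentMod p a
    independent-a c p∣∑ca = independent c λ j →
      subst (p ∣_) (eval-∑ca≡∑cf j) (∣-eval n s _ p∣∑ca (Y j))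
      where
      eval-∑ca≡∑cf : ∀ j → eval n s (λ k → ∑[ i < m ] (c i * a i k)) (Y j) ≡
                           ∑[ i < m ] (c i * f i (Y j))
      eval-∑ca≡∑cf j = trans (eval-linear n s c a (Y j))
                              (sum-cong-≗ λ i → cong (c i *_) (sym (proj₂ (f-poly i) (Y j))))

theorem1p4 : (p q s b n : ℕ) → Prime p → ∃ (λ k → q ≡ p ^ k) →
    1 ≤ s → s ≤ b → b < q → ¬ (p ∣ (b C s)) → 1 ≤ n →
    (F : List (Subset n)) → Unique F → ModDiffSperner q (inL s b) F →
    length F ≤ sumBinom (n ∸ 1) s
theorem1p4 p q s b zero    _ _ _ _ _ _ () _ _ _
theorem1p4 p .(p ^ k) s b (suc n) p-prime (k , refl) _ s≤b b<q p∤bCs _ F unique sperner =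
  subst (length F ≤_) (polyDim≡sumBinom n s)
    (independentMod-polynomials⇒≤polyDim p-prime f (tail ∘ A) f-isPolynomial
      (blockTriangular⇒independentMod p-prime _ (head ∘ A) diagonal offDiagonal))
  where
  A = lookup F
  f : Fin (length F) → Subset n → ℕ
  f i Y = (b + n * p ^ k ∸ ∣ tail (A i) ─ Y ∣) C s
  f-isPolynomial : ∀ i → IsPolynomial n s (f i)
  f-isPolynomial i = [c∸∣X─Y∣]Cs-isPolynomial n s _ (tail (A i)) (n≤b+n*p^k p-prime k b n)
  diagonal : ∀ j → p ∤ f j (tail (A j))
  diagonal j rewrite ∣X─X∣≡0 (tail (A j)) =
    p∤[b+n*p^k]Cs p-prime {k} n (≤-<-trans s≤b b<q) p∤bCs
  offDiagonal : ∀ i j → i ≢ j → head (A i) Bool.≤ head (A j) → p ∣ f i (tail (A j))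
  offDiagonal i j i≢j hi≤hj
    with ℓ , ℓ∈L , d≡ℓ ← sperner (A i) (A j) (∈-lookup i) (∈-lookup j)
                                  (i≢j ∘ lookup-injective unique i j) =
    p∣[b+n*p^k∸d]Cs p-prime {k} {n = n} s≤b b<q (∣p∣≤n (tail (A i) ─ tail (A j))) ℓ∈L
      (subst (λ d → d ≡ ℓ [mod p ^ k ]) (∣A─B∣≡∣tailA─tailB∣ (A i) (A j) hi≤hj) d≡ℓ)
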